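{- Let $M$ and $N$ be $\lambda$-terms. Assume there exists a reduct $N'$ of $N$ (i.e., $N \twoheadrightarrow_\beta N'$) such that for no reduct $M'$ of $M$ we have $M' \sqsubseteq N'$ (clock relation with $\leq$). Then $M \neq_\beta N$.
   Context: Untyped $\lambda$-calculus. A head reduction step is a step $\lambda x_1\ldots x_n.(\lambda y.M)N N_1\ldots N_m \to \lambda x_1\ldots x_n.M[y:=N]N_1\ldots N_m$; a head normal form (hnf) is a term $\lambda x_1\ldots x_n.\,y N_1\ldots N_m$. The clocked Böhm tree $\mathrm{CBT}(t)$ is defined corecursively: if $t$ has no hnf, $\mathrm{CBT}(t)=\bot$ (unannotated); otherwise $t$ head-reduces in exactly $k$ head steps to a hnf $\lambda x_1\ldots x_n.\,y M_1\ldots M_m$ and $\mathrm{CBT}(t)$ is $\lambda x_1\ldots x_n.\,y\,\mathrm{CBT}(M_1)\ldots\mathrm{CBT}(M_m)$ with root annotated by $k$. The Böhm tree $\mathrm{BT}(t)$ is $\mathrm{CBT}(t)$ with annotations removed. For a relation $R$ on $\mathbb{N}$ and trees $T_1,T_2$ with the same set of positions, $T_1\, R\, T_2$ means that at every position either both subtrees are unannotated or both are annotated with $k_1, k_2$ and $k_1 R k_2$. For terms, $M' \sqsubseteq N'$ means $\mathrm{BT}(M') = \mathrm{BT}(N')$ and $\mathrm{CBT}(M') \leq \mathrm{CBT}(N')$ in this sense. -}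

module Defs where

open import Data.Nat using (ℕ; zero; suc; _+_; _∸_; _≤_; _<ᵇ_; _≡ᵇ_)
open import Data.Bool using (if_then_else_)
open import Data.List using (List; []; _∷_; length; lookup)
open import Data.Fin using (Fin; toℕ)
open import Data.Product using (Σ; ∃; _×_; _,_)
open import Data.Sum using (_⊎_)
open import Relation.Nullary using (¬_)
open import Relation.Binary.PropositionalEquality using (_≡_)
open import Relation.Binary.Construct.Closure.ReflexiveTransitive using (Star)
open import Relation.Binary.Construct.Closure.Equivalence using (EqClosure)

-- Untyped λ-terms (de Bruijn indices; free variables allowed)

data Term : Set where
  var : ℕ → Term
  lam : Term → Term
  app : Term → Term → Term

shift : ℕ → ℕ → Term → Term
shift c d (var x)   = if x <ᵇ c then var x else var (x + d)
shift c d (lam t)   = lam (shift (suc c) d t)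
shift c d (app t u) = app (shift c d t) (shift c d u)

-- subst j s t : replace variable j of t by s (s lives outside the j binders),
-- decrementing the variables above j (the binder being removed)
subst : ℕ → Term → Term → Term
subst j s (var x)   = if x <ᵇ j then var x else (if x ≡ᵇ j then shift 0 j s else var (x ∸ 1))
subst j s (lam t)   = lam (subst (suc j) s t)
subst j s (app t u) = app (subst j s t) (subst j s u)

-- M [ N ] : the contractum of (λ.M) N
_[_] : Term → Term → Term
M [ N ] = subst 0 N M

infix 4 _→β_ _↠β_ _=β_

data _→β_ : Term → Term → Set where
  β    : ∀ {M N} → app (lam M) N →β M [ N ]
  ξlam : ∀ {M M'} → M →β M' → lam M →β lam M'
  ξl   : ∀ {M M' N} → M →β M' → app M N →β app M' N
  ξr   : ∀ {M N N'} → N →β N' → app M N →β app M N'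

_↠β_ : Term → Term → Set
_↠β_ = Star _→β_

_=β_ : Term → Term → Set
_=β_ = EqClosure _→β_

lams : ℕ → Term → Term
lams zero    t = t
lams (suc n) t = lam (lams n t)

apps : Term → List Term → Term
apps h []       = h
apps h (N ∷ Ns) = apps (app h N) Ns

data _→h_ : Term → Term → Set where
  head : ∀ n M N Ns → lams n (apps (app (lam M) N) Ns) →h lams n (apps (M [ N ]) Ns)

data HeadSteps : ℕ → Term → Term → Set where
  done : ∀ {t} → HeadSteps zero t t
  step : ∀ {k t u v} → t →h u → HeadSteps k u v → HeadSteps (suc k) t v

HeadToHnf : Term → ℕ → ℕ → ℕ → List Term → Set
HeadToHnf t k n y Ms = HeadSteps k t (lams n (apps (var y) Ms))

HasHnf : Term → Set
HasHnf t = Σ ℕ λ k → Σ ℕ λ n → Σ ℕ λ y → Σ (List Term) λ Ms → HeadToHnf t k n y Ms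

-- Clocked Böhm trees, as labelled trees indexed by positions (List ℕ)

-- node label of a clocked Böhm tree:
--   bot            : ⊥ (unannotated)
--   node k n y m   : λx₁…xₙ. y with m children, root annotated by k
data Label : Set where
  bot  : Label
  node : (k n y m : ℕ) → Label

data CBTAt : Term → List ℕ → Label → Set where
  here-bot  : ∀ {t} → ¬ HasHnf t → CBTAt t [] bot
  here-node : ∀ {t k n y Ms} → HeadToHnf t k n y Ms →
              CBTAt t [] (node k n y (length Ms))
  child     : ∀ {t k n y Ms p ℓ} → HeadToHnf t k n y Ms →
              (i : Fin (length Ms)) → CBTAt (lookup Ms i) p ℓ →
              CBTAt t (toℕ i ∷ p) ℓ

TreeRel : (Label → Label → Set) → Term → Term → Set
TreeRel L s t =
  ∀ p → (∀ ℓ₁ → CBTAt s p ℓ₁ → ∃ λ ℓ₂ → CBTAt t p ℓ₂ × L ℓ₁ ℓ₂)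
      × (∀ ℓ₂ → CBTAt t p ℓ₂ → ∃ λ ℓ₁ → CBTAt s p ℓ₁ × L ℓ₁ ℓ₂)

-- equality of Böhm-tree labels (annotations erased)
data BTLabelEq : Label → Label → Set where
  bot  : BTLabelEq bot bot
  node : ∀ {k₁ k₂ n y m} → BTLabelEq (node k₁ n y m) (node k₂ n y m)

data ClockRel (R : ℕ → ℕ → Set) : Label → Label → Set where
  bot  : ClockRel R bot bot
  node : ∀ {k₁ k₂ n₁ y₁ m₁ n₂ y₂ m₂} → R k₁ k₂ →
         ClockRel R (node k₁ n₁ y₁ m₁) (node k₂ n₂ y₂ m₂)

BTEq : Term → Term → Set
BTEq = TreeRel BTLabelEq

CBTRel : (ℕ → ℕ → Set) → Term → Term → Set
CBTRel R = TreeRel (ClockRel R)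

infix 4 _⊑_
_⊑_ : Term → Term → Set
M ⊑ N = BTEq M N × CBTRel _≤_ M N

module Submission where

-- Suppose M =β N.  As N ↠β N', also M =β N', so by Church–Rosser M and N'
-- have a common reduct Z.  The heart of the proof is that β-reduction only
-- speeds up the clocked Böhm tree:  A ↠β B  implies  B ⊑ A  (same Böhm tree,
-- and at every position B needs no more head steps than A).  Taking A = N',
-- B = Z gives a reduct Z of M with Z ⊑ N', contradicting the hypothesis.

open import Defs
open import Data.Nat using (ℕ; zero; suc; _+_; _∸_; _≤_; z≤n; s≤s; _<ᵇ_; _≡ᵇ_)
open import Data.Nat.Properties using (+-suc; +-identityʳ; ≤-trans; ≤-refl; m≤n+m)
open import Data.Bool using (Bool; true; false; if_then_else_)
open import Data.List using (List; []; _∷_; length; lookup; _++_)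
open import Data.List.Properties using (++-identityʳ)
open import Data.List.Relation.Binary.Pointwise
  using (Pointwise; []; _∷_; Pointwise-length; lookup⁺; symmetric; transitive; ++⁺)
  renaming (refl to pointwise-refl)
open import Data.Fin using (Fin; toℕ; cast)
open import Data.Fin.Properties using (toℕ-cast)
open import Data.Empty using (⊥; ⊥-elim)
open import Data.Product using (∃; _×_; _,_; proj₁; proj₂; map₂)
open import Function using (_∘_)
open import Level using (0ℓ)
open import Relation.Nullary using (¬_)
open import Relation.Binary.Core using (Rel)
open import Relation.Binary.PropositionalEquality
  using (_≡_; _≗_; refl; sym; trans; cong; cong₂; module ≡-Reasoning) renaming (subst to transport)
open import Relation.Binary.Construct.Closure.ReflexiveTransitive as RT using (Star; ε; _◅_; _◅◅_)
open import Relation.Binary.Construct.Closure.Symmetric using (fwd; bwd)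
open import Relation.Binary.Construct.Closure.Equivalence using (EqClosure)
open import Relation.Binary.Construct.Closure.Equivalence.Properties using (a—↠b⇒a↔b)
open import Relation.Binary.Rewriting using (Confluent)

-- 1. Renaming and simultaneous substitution

Ren : Set
Ren = ℕ → ℕ

Sub : Set
Sub = ℕ → Term

lift : Ren → Ren
lift ρ zero    = zero
lift ρ (suc x) = suc (ρ x)

ren : Ren → Term → Term
ren ρ (var x)   = var (ρ x)
ren ρ (lam t)   = lam (ren (lift ρ) t)
ren ρ (app t u) = app (ren ρ t) (ren ρ u)

exts : Sub → Sub
exts σ zero    = var zero
exts σ (suc x) = ren suc (σ x)

sub : Sub → Term → Term
sub σ (var x)   = σ x
sub σ (lam t)   = lam (sub (exts σ) t)
sub σ (app t u) = app (sub σ t) (sub σ u)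

_•id : Term → Sub
(N •id) zero    = N
(N •id) (suc x) = var x

lift-cong : ∀ {ρ ρ'} → ρ ≗ ρ' → lift ρ ≗ lift ρ'
lift-cong e zero    = refl
lift-cong e (suc x) = cong suc (e x)

ren-cong : ∀ {ρ ρ'} → ρ ≗ ρ' → ∀ t → ren ρ t ≡ ren ρ' t
ren-cong e (var x)   = cong var (e x)
ren-cong e (lam t)   = cong lam (ren-cong (lift-cong e) t)
ren-cong e (app t u) = cong₂ app (ren-cong e t) (ren-cong e u)

exts-cong : ∀ {σ σ'} → σ ≗ σ' → exts σ ≗ exts σ'
exts-cong e zero    = refl
exts-cong e (suc x) = cong (ren suc) (e x)

sub-cong : ∀ {σ σ'} → σ ≗ σ' → ∀ t → sub σ t ≡ sub σ' t
sub-cong e (var x)   = e x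
sub-cong e (lam t)   = cong lam (sub-cong (exts-cong e) t)
sub-cong e (app t u) = cong₂ app (sub-cong e t) (sub-cong e u)

ren-ren : ∀ ρ ρ' t → ren ρ (ren ρ' t) ≡ ren (ρ ∘ ρ') t
ren-ren ρ ρ' (var x)   = refl
ren-ren ρ ρ' (lam t)   =
  cong lam (trans (ren-ren (lift ρ) (lift ρ') t) (ren-cong (λ { zero → refl ; (suc x) → refl }) t))
ren-ren ρ ρ' (app t u) = cong₂ app (ren-ren ρ ρ' t) (ren-ren ρ ρ' u)

sub-ren : ∀ σ ρ t → sub σ (ren ρ t) ≡ sub (σ ∘ ρ) t
sub-ren σ ρ (var x)   = refl
sub-ren σ ρ (lam t)   =
  cong lam (trans (sub-ren (exts σ) (lift ρ) t) (sub-cong (λ { zero → refl ; (suc x) → refl }) t))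
sub-ren σ ρ (app t u) = cong₂ app (sub-ren σ ρ t) (sub-ren σ ρ u)

ren-sub : ∀ ρ σ t → ren ρ (sub σ t) ≡ sub (ren ρ ∘ σ) t
ren-sub ρ σ (var x)   = refl
ren-sub ρ σ (lam t)   = cong lam (trans (ren-sub (lift ρ) (exts σ) t) (sub-cong lift-exts t))
  where
  lift-exts : ren (lift ρ) ∘ exts σ ≗ exts (ren ρ ∘ σ)
  lift-exts zero    = refl
  lift-exts (suc x) = trans (ren-ren (lift ρ) suc (σ x)) (sym (ren-ren suc ρ (σ x)))
ren-sub ρ σ (app t u) = cong₂ app (ren-sub ρ σ t) (ren-sub ρ σ u)

sub-sub : ∀ σ τ t → sub σ (sub τ t) ≡ sub (sub σ ∘ τ) t
sub-sub σ τ (var x)   = refl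
sub-sub σ τ (lam t)   = cong lam (trans (sub-sub (exts σ) (exts τ) t) (sub-cong exts-exts t))
  where
  exts-exts : sub (exts σ) ∘ exts τ ≗ exts (sub σ ∘ τ)
  exts-exts zero    = refl
  exts-exts (suc x) = trans (sub-ren (exts σ) suc (τ x)) (sym (ren-sub suc σ (τ x)))
sub-sub σ τ (app t u) = cong₂ app (sub-sub σ τ t) (sub-sub σ τ u)

sub-var : ∀ t → sub var t ≡ t
sub-var (var x)   = refl
sub-var (lam t)   = cong lam (trans (sub-cong (λ { zero → refl ; (suc x) → refl }) t) (sub-var t))
sub-var (app t u) = cong₂ app (sub-var t) (sub-var u)

ren-id : ∀ {ρ} → ρ ≗ (λ x → x) → ∀ t → ren ρ t ≡ t
ren-id e (var x)   = cong var (e x)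
ren-id e (lam t)   = cong lam (ren-id (λ { zero → refl ; (suc x) → cong suc (e x) }) t)
ren-id e (app t u) = cong₂ app (ren-id e t) (ren-id e u)

-- The shift and substitution of Defs are instances of ren and sub.

liftⁿ : ℕ → Ren → Ren
liftⁿ zero    ρ = ρ
liftⁿ (suc c) ρ = lift (liftⁿ c ρ)

extsⁿ : ℕ → Sub → Sub
extsⁿ zero    σ = σ
extsⁿ (suc j) σ = exts (extsⁿ j σ)

if-var : ∀ (b : Bool) a c → (if b then var a else var c) ≡ var (if b then a else c)
if-var true  a c = refl
if-var false a c = refl

shift-index : ∀ c d x → (if x <ᵇ c then x else x + d) ≡ liftⁿ c (_+ d) x
shift-index zero    d x       = refl
shift-index (suc c) d zero    = refl
shift-index (suc c) d (suc x) with x <ᵇ c | shift-index c d x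
... | true  | ih = cong suc ih
... | false | ih = cong suc ih

shift-as-ren : ∀ c d t → shift c d t ≡ ren (liftⁿ c (_+ d)) t
shift-as-ren c d (var x)   = trans (if-var (x <ᵇ c) x (x + d)) (cong var (shift-index c d x))
shift-as-ren c d (lam t)   = cong lam (shift-as-ren (suc c) d t)
shift-as-ren c d (app t u) = cong₂ app (shift-as-ren c d t) (shift-as-ren c d u)

shift-zero : ∀ N → shift 0 0 N ≡ N
shift-zero N = trans (shift-as-ren 0 0 N) (ren-id +-identityʳ N)

shift-suc : ∀ j N → shift 0 (suc j) N ≡ ren suc (shift 0 j N)
shift-suc j N = trans (shift-as-ren 0 (suc j) N) (trans (ren-cong (λ x → +-suc x j) N)
  (trans (sym (ren-ren suc (_+ j) N)) (cong (ren suc) (sym (shift-as-ren 0 j N)))))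

subst-var-as-sub : ∀ N j x →
  (if x <ᵇ j then var x else (if x ≡ᵇ j then shift 0 j N else var (x ∸ 1))) ≡ extsⁿ j (N •id) x
subst-var-as-sub N zero          zero          = shift-zero N
subst-var-as-sub N zero          (suc x)       = refl
subst-var-as-sub N (suc j)       zero          = refl
subst-var-as-sub N (suc zero)    (suc zero)    = trans (shift-suc 0 N) (cong (ren suc) (shift-zero N))
subst-var-as-sub N (suc (suc j)) (suc zero)    = refl
subst-var-as-sub N (suc j)       (suc (suc x)) with suc x <ᵇ j | suc x ≡ᵇ j | subst-var-as-sub N j (suc x)
... | true  | _     | ih = cong (ren suc) ih
... | false | true  | ih = trans (shift-suc j N) (cong (ren suc) ih)
... | false | false | ih = cong (ren suc) ih

subst-as-sub : ∀ j N M → subst j N M ≡ sub (extsⁿ j (N •id)) M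
subst-as-sub j N (var x)   = subst-var-as-sub N j x
subst-as-sub j N (lam M)   = cong lam (subst-as-sub (suc j) N M)
subst-as-sub j N (app M L) = cong₂ app (subst-as-sub j N M) (subst-as-sub j N L)

[]-as-sub : ∀ M N → M [ N ] ≡ sub (N •id) M
[]-as-sub M N = subst-as-sub 0 N M

sub-[] : ∀ σ M N → sub σ (M [ N ]) ≡ sub (exts σ) M [ sub σ N ]
sub-[] σ M N = begin
  sub σ (M [ N ])                        ≡⟨ cong (sub σ) ([]-as-sub M N) ⟩
  sub σ (sub (N •id) M)                  ≡⟨ sub-sub σ (N •id) M ⟩
  sub (sub σ ∘ (N •id)) M                ≡⟨ sub-cong pointwise M ⟩
  sub (sub (sub σ N •id) ∘ exts σ) M     ≡⟨ sym (sub-sub (sub σ N •id) (exts σ) M) ⟩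
  sub (sub σ N •id) (sub (exts σ) M)     ≡⟨ sym ([]-as-sub (sub (exts σ) M) (sub σ N)) ⟩
  sub (exts σ) M [ sub σ N ]             ∎
  where
  open ≡-Reasoning
  pointwise : sub σ ∘ (N •id) ≗ sub (sub σ N •id) ∘ exts σ
  pointwise zero    = refl
  pointwise (suc x) = sym (trans (sub-ren (sub σ N •id) suc (σ x)) (sub-var (σ x)))

ren-[] : ∀ ρ M N → ren ρ (M [ N ]) ≡ ren (lift ρ) M [ ren ρ N ]
ren-[] ρ M N = begin
  ren ρ (M [ N ])                        ≡⟨ cong (ren ρ) ([]-as-sub M N) ⟩
  ren ρ (sub (N •id) M)                  ≡⟨ ren-sub ρ (N •id) M ⟩
  sub (ren ρ ∘ (N •id)) M                ≡⟨ sub-cong (λ { zero → refl ; (suc x) → refl }) M ⟩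
  sub ((ren ρ N •id) ∘ lift ρ) M         ≡⟨ sym (sub-ren (ren ρ N •id) (lift ρ) M) ⟩
  sub (ren ρ N •id) (ren (lift ρ) M)     ≡⟨ sym ([]-as-sub (ren (lift ρ) M) (ren ρ N)) ⟩
  ren (lift ρ) M [ ren ρ N ]             ∎
  where open ≡-Reasoning

-- 2. Confluence and Church–Rosser

-- Takahashi: a relation with a "complete development" f, such that every
-- step a ⇉ b can be closed by b ⇉ f a (triangle property), is confluent.
triangle⇒confluent : ∀ {A : Set} {_⇉_ : Rel A 0ℓ} (f : A → A) →
                     (∀ {a b} → a ⇉ b → b ⇉ f a) → Confluent _⇉_
triangle⇒confluent {_⇉_ = _⇉_} f triangle = confluent
  where
  strip : ∀ {a b c} → a ⇉ b → Star _⇉_ a c → ∃ λ d → Star _⇉_ b d × c ⇉ d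
  strip {b = b} p ε        = b , ε , p
  strip p (q ◅ qs) with strip (triangle q) qs
  ... | d , bd , cd = d , triangle p ◅ bd , cd

  confluent : Confluent _⇉_
  confluent {C = c} ε qs = c , qs , ε
  confluent (p ◅ ps) qs with strip p qs
  ... | d , bd , cd with confluent ps bd
  ... | e , be , de = e , be , cd ◅ de

confluent-between : ∀ {A : Set} {R S : Rel A 0ℓ} →
                    (∀ {a b} → R a b → S a b) → (∀ {a b} → S a b → Star R a b) →
                    Confluent S → Confluent R
confluent-between R⊆S S⊆R* confluent r₁ r₂ with confluent (RT.map R⊆S r₁) (RT.map R⊆S r₂)
... | d , s₁ , s₂ = d , RT.concat (RT.map S⊆R* s₁) , RT.concat (RT.map S⊆R* s₂)

confluent⇒church-rosser : ∀ {A : Set} {R : Rel A 0ℓ} → Confluent R →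
                          ∀ {a b} → EqClosure R a b → ∃ λ c → Star R a c × Star R b c
confluent⇒church-rosser confluent ε = _ , ε , ε
confluent⇒church-rosser confluent (fwd r ◅ rs) with confluent⇒church-rosser confluent rs
... | c , ac , bc = c , r ◅ ac , bc
confluent⇒church-rosser confluent (bwd r ◅ rs) with confluent⇒church-rosser confluent rs
... | c , a'c , bc with confluent (r ◅ ε) a'c
... | d , ad , cd = d , ad , bc ◅◅ cd

infix 4 _⇛_
data _⇛_ : Term → Term → Set where
  pvar : ∀ {x} → var x ⇛ var x
  plam : ∀ {M M'} → M ⇛ M' → lam M ⇛ lam M'
  papp : ∀ {M M' N N'} → M ⇛ M' → N ⇛ N' → app M N ⇛ app M' N'
  pβ   : ∀ {M M' N N'} → M ⇛ M' → N ⇛ N' → app (lam M) N ⇛ M' [ N' ]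

⇛-refl : ∀ M → M ⇛ M
⇛-refl (var x)   = pvar
⇛-refl (lam M)   = plam (⇛-refl M)
⇛-refl (app M N) = papp (⇛-refl M) (⇛-refl N)

ren-⇛ : ∀ ρ {M M'} → M ⇛ M' → ren ρ M ⇛ ren ρ M'
ren-⇛ ρ pvar       = pvar
ren-⇛ ρ (plam p)   = plam (ren-⇛ (lift ρ) p)
ren-⇛ ρ (papp p q) = papp (ren-⇛ ρ p) (ren-⇛ ρ q)
ren-⇛ ρ (pβ {M' = M'} {N' = N'} p q) =
  transport (_ ⇛_) (sym (ren-[] ρ M' N')) (pβ (ren-⇛ (lift ρ) p) (ren-⇛ ρ q))

exts-⇛ : ∀ {σ τ} → (∀ x → σ x ⇛ τ x) → ∀ x → exts σ x ⇛ exts τ x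
exts-⇛ στ zero    = pvar
exts-⇛ στ (suc x) = ren-⇛ suc (στ x)

sub-⇛ : ∀ {σ τ} → (∀ x → σ x ⇛ τ x) → ∀ {M M'} → M ⇛ M' → sub σ M ⇛ sub τ M'
sub-⇛ στ pvar       = στ _
sub-⇛ στ (plam p)   = plam (sub-⇛ (exts-⇛ στ) p)
sub-⇛ στ (papp p q) = papp (sub-⇛ στ p) (sub-⇛ στ q)
sub-⇛ {τ = τ} στ (pβ {M' = M'} {N' = N'} p q) =
  transport (_ ⇛_) (sym (sub-[] τ M' N')) (pβ (sub-⇛ (exts-⇛ στ) p) (sub-⇛ στ q))

•id-⇛ : ∀ {N N'} → N ⇛ N' → ∀ x → (N •id) x ⇛ (N' •id) x
•id-⇛ q zero    = q
•id-⇛ q (suc x) = pvar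

[]-⇛ : ∀ {M M' N N'} → M ⇛ M' → N ⇛ N' → M [ N ] ⇛ M' [ N' ]
[]-⇛ {M} {M'} {N} {N'} p q
  rewrite []-as-sub M N | []-as-sub M' N' = sub-⇛ (•id-⇛ q) p

develop : Term → Term
develop (var x)         = var x
develop (lam M)         = lam (develop M)
develop (app (lam M) N) = develop M [ develop N ]
develop (app M N)       = app (develop M) (develop N)

⇛-triangle : ∀ {M N} → M ⇛ N → N ⇛ develop M
⇛-triangle pvar                  = pvar
⇛-triangle (plam p)              = plam (⇛-triangle p)
⇛-triangle (pβ p q)              = []-⇛ (⇛-triangle p) (⇛-triangle q)
⇛-triangle (papp (plam p) q)     = pβ (⇛-triangle p) (⇛-triangle q)
⇛-triangle (papp pvar q)         = papp pvar (⇛-triangle q)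
⇛-triangle (papp p@(papp _ _) q) = papp (⇛-triangle p) (⇛-triangle q)
⇛-triangle (papp p@(pβ _ _) q)   = papp (⇛-triangle p) (⇛-triangle q)

→β⊆⇛ : ∀ {M N} → M →β N → M ⇛ N
→β⊆⇛ {app (lam M) N} β = pβ (⇛-refl M) (⇛-refl N)
→β⊆⇛ (ξlam s)          = plam (→β⊆⇛ s)
→β⊆⇛ {app _ N} (ξl s)  = papp (→β⊆⇛ s) (⇛-refl N)
→β⊆⇛ {app M _} (ξr s)  = papp (⇛-refl M) (→β⊆⇛ s)

⇛⊆↠β : ∀ {M N} → M ⇛ N → M ↠β N
⇛⊆↠β pvar       = ε
⇛⊆↠β (plam p)   = RT.gmap lam ξlam (⇛⊆↠β p)
⇛⊆↠β (papp p q) = RT.gmap (λ M → app M _) ξl (⇛⊆↠β p) ◅◅ RT.gmap (app _) ξr (⇛⊆↠β q)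
⇛⊆↠β (pβ p q)   = RT.gmap (λ M → app (lam M) _) (ξl ∘ ξlam) (⇛⊆↠β p)
                  ◅◅ RT.gmap (app _) ξr (⇛⊆↠β q) ◅◅ β ◅ ε

β-confluent : Confluent _→β_
β-confluent = confluent-between →β⊆⇛ ⇛⊆↠β (triangle⇒confluent develop ⇛-triangle)

-- 3. Head reduction

-- This compositional
-- presentation is equivalent to the →h of Defs.
infix 4 _⟶ʷ_ _⟶h_
data _⟶ʷ_ : Term → Term → Set where
  wβ   : ∀ {M N} → app (lam M) N ⟶ʷ M [ N ]
  wapp : ∀ {M M' N} → M ⟶ʷ M' → app M N ⟶ʷ app M' N

data _⟶h_ : Term → Term → Set where
  hlam  : ∀ {M M'} → M ⟶h M' → lam M ⟶h lam M'
  hweak : ∀ {M M'} → M ⟶ʷ M' → M ⟶h M'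

apps-snoc : ∀ h Ns N → apps h (Ns ++ N ∷ []) ≡ app (apps h Ns) N
apps-snoc h []       N = refl
apps-snoc h (x ∷ Ns) N = apps-snoc (app h x) Ns N

apps-⟶ʷ : ∀ {h h'} Ns → h ⟶ʷ h' → apps h Ns ⟶ʷ apps h' Ns
apps-⟶ʷ []       s = s
apps-⟶ʷ (N ∷ Ns) s = apps-⟶ʷ Ns (wapp s)

lams-⟶h : ∀ n {t u} → t ⟶h u → lams n t ⟶h lams n u
lams-⟶h zero    s = s
lams-⟶h (suc n) s = hlam (lams-⟶h n s)

→h⇒⟶h : ∀ {t u} → t →h u → t ⟶h u
→h⇒⟶h (head n M N Ns) = lams-⟶h n (hweak (apps-⟶ʷ Ns wβ))

⟶ʷ-shape : ∀ {M M'} → M ⟶ʷ M' → ∃ λ P → ∃ λ Q → ∃ λ Ns →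
           (M ≡ apps (app (lam P) Q) Ns) × (M' ≡ apps (P [ Q ]) Ns)
⟶ʷ-shape (wβ {M} {N}) = M , N , [] , refl , refl
⟶ʷ-shape (wapp {N = N} s) with ⟶ʷ-shape s
... | P , Q , Ns , refl , refl = P , Q , Ns ++ N ∷ [] , sym (apps-snoc _ Ns N) , sym (apps-snoc _ Ns N)

⟶h⇒→h : ∀ {t u} → t ⟶h u → t →h u
⟶h⇒→h (hlam s) with ⟶h⇒→h s
... | head n M N Ns = head (suc n) M N Ns
⟶h⇒→h (hweak s) with ⟶ʷ-shape s
... | P , Q , Ns , refl , refl = head 0 P Q Ns

⟶h⊆→β : ∀ {t u} → t ⟶h u → t →β u
⟶h⊆→β (hlam s)         = ξlam (⟶h⊆→β s)
⟶h⊆→β (hweak wβ)       = β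
⟶h⊆→β (hweak (wapp s)) = ξl (⟶h⊆→β (hweak s))

HeadSteps⊆↠β : ∀ {k t u} → HeadSteps k t u → t ↠β u
HeadSteps⊆↠β done        = ε
HeadSteps⊆↠β (step s ss) = ⟶h⊆→β (→h⇒⟶h s) ◅ HeadSteps⊆↠β ss

HeadSteps-++ : ∀ {a b t u v} → HeadSteps a t u → HeadSteps b u v → HeadSteps (a + b) t v
HeadSteps-++ done       q = q
HeadSteps-++ (step s p) q = step s (HeadSteps-++ p q)

weak⇒HeadSteps : ∀ {t u} → Star _⟶ʷ_ t u → ∃ λ j → HeadSteps j t u
weak⇒HeadSteps ε = 0 , done
weak⇒HeadSteps (s ◅ ss) with weak⇒HeadSteps ss
... | j , p = suc j , step (⟶h⇒→h (hweak s)) p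

HeadSteps-lam : ∀ {k X Y} → HeadSteps k X Y → HeadSteps k (lam X) (lam Y)
HeadSteps-lam done        = done
HeadSteps-lam (step s ss) = step (⟶h⇒→h (hlam (→h⇒⟶h s))) (HeadSteps-lam ss)

HeadSteps-unlam : ∀ {k X T} → HeadSteps k (lam X) T → ∃ λ T₀ → (T ≡ lam T₀) × HeadSteps k X T₀
HeadSteps-unlam done = _ , refl , done
HeadSteps-unlam (step s ss) with →h⇒⟶h s
... | hlam s' with HeadSteps-unlam ss
... | T₀ , refl , ss' = T₀ , refl , step (⟶h⇒→h s') ss'

data Neutral (y : ℕ) : Term → Set where
  nvar : Neutral y (var y)
  napp : ∀ {f a} → Neutral y f → Neutral y (app f a)

apps-neutral : ∀ {y h} Ms → Neutral y h → Neutral y (apps h Ms)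
apps-neutral []       n = n
apps-neutral (M ∷ Ms) n = apps-neutral Ms (napp n)

neutral-spine : ∀ {y t} → Neutral y t → ∃ λ Ms → t ≡ apps (var y) Ms
neutral-spine nvar = [] , refl
neutral-spine (napp {a = a} n) with neutral-spine n
... | Ms , refl = Ms ++ a ∷ [] , sym (apps-snoc _ Ms a)

neutral-not-lam : ∀ {y t X} → Neutral y t → t ≡ lam X → ⊥
neutral-not-lam nvar     ()
neutral-not-lam (napp n) ()

neutral-⟶h-normal : ∀ {y t u} → Neutral y t → ¬ (t ⟶h u)
neutral-⟶h-normal (napp ()) (hweak wβ)
neutral-⟶h-normal (napp n)  (hweak (wapp s)) = neutral-⟶h-normal n (hweak s)

hnf-⟶h-normal : ∀ n y Ms {u} → ¬ (lams n (apps (var y) Ms) ⟶h u)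
hnf-⟶h-normal zero    y Ms s          = neutral-⟶h-normal (apps-neutral Ms nvar) s
hnf-⟶h-normal (suc n) y Ms (hlam s)   = hnf-⟶h-normal n y Ms s
hnf-⟶h-normal (suc n) y Ms (hweak ())

⟶h-deterministic : ∀ {t u v} → t ⟶h u → t ⟶h v → u ≡ v
⟶h-deterministic (hlam s)          (hlam s')          = cong lam (⟶h-deterministic s s')
⟶h-deterministic (hweak wβ)        (hweak wβ)         = refl
⟶h-deterministic (hweak (wapp s))  (hweak (wapp s'))  = cong (λ z → app z _) (⟶h-deterministic (hweak s) (hweak s'))
⟶h-deterministic (hweak (wapp ())) (hweak wβ)
⟶h-deterministic (hweak wβ)        (hweak (wapp ()))

HeadSteps-deterministic : ∀ {k k' t H H'} → (∀ {u} → ¬ (H ⟶h u)) → (∀ {u} → ¬ (H' ⟶h u)) →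
                          HeadSteps k t H → HeadSteps k' t H' → (k ≡ k') × (H ≡ H')
HeadSteps-deterministic nf nf' done       done        = refl , refl
HeadSteps-deterministic nf nf' done       (step s q)  = ⊥-elim (nf (→h⇒⟶h s))
HeadSteps-deterministic nf nf' (step s p) done        = ⊥-elim (nf' (→h⇒⟶h s))
HeadSteps-deterministic nf nf' (step s p) (step s' q)
  with ⟶h-deterministic (→h⇒⟶h s) (→h⇒⟶h s')
... | refl with HeadSteps-deterministic nf nf' p q
... | refl , e = refl , e

spine-head : Term → Term
spine-head (app f a) = spine-head f
spine-head t         = t

spine-args : Term → List Term → List Term
spine-args (app f a) acc = spine-args f (a ∷ acc)
spine-args t         acc = acc

spine-head-apps : ∀ h Ms → spine-head (apps h Ms) ≡ spine-head h
spine-head-apps h []       = refl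
spine-head-apps h (M ∷ Ms) = spine-head-apps (app h M) Ms

spine-args-apps : ∀ h Ms acc → spine-args (apps h Ms) acc ≡ spine-args h (Ms ++ acc)
spine-args-apps h []       acc = refl
spine-args-apps h (M ∷ Ms) acc = spine-args-apps (app h M) Ms acc

hnf-injective : ∀ n y Ms n' y' Ms' → lams n (apps (var y) Ms) ≡ lams n' (apps (var y') Ms') →
                (n ≡ n') × (y ≡ y') × (Ms ≡ Ms')
hnf-injective zero y Ms zero y' Ms' e = refl , var-injective heads , args
  where
  var-injective : ∀ {a b} → var a ≡ var b → a ≡ b
  var-injective refl = refl
  heads : var y ≡ var y'
  heads = trans (sym (spine-head-apps (var y) Ms)) (trans (cong spine-head e) (spine-head-apps (var y') Ms'))
  args : Ms ≡ Ms'
  args = begin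
    Ms                                   ≡⟨ sym (++-identityʳ Ms) ⟩
    Ms ++ []                             ≡⟨ sym (spine-args-apps (var y) Ms []) ⟩
    spine-args (apps (var y) Ms) []      ≡⟨ cong (λ t → spine-args t []) e ⟩
    spine-args (apps (var y') Ms') []    ≡⟨ spine-args-apps (var y') Ms' [] ⟩
    Ms' ++ []                            ≡⟨ ++-identityʳ Ms' ⟩
    Ms'                                  ∎
    where open ≡-Reasoning
hnf-injective zero    y Ms (suc n') y' Ms' e = ⊥-elim (neutral-not-lam (apps-neutral Ms nvar) e)
hnf-injective (suc n) y Ms zero     y' Ms' e = ⊥-elim (neutral-not-lam (apps-neutral Ms' nvar) (sym e))
hnf-injective (suc n) y Ms (suc n') y' Ms' e with hnf-injective n y Ms n' y' Ms' (cong body e)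
  where
  body : Term → Term
  body (lam t) = t
  body t       = t
... | refl , same = refl , same

-- 4. Postponing head steps after a parallel step

-- Internal parallel steps contract no redex on the head spine: ⇛ˢ acts on
-- application spines (a head redex may only be reduced inside), ⇛ᶦ also lets
-- a leading λ be reduced arbitrarily underneath.
infix 4 _⇛ˢ_ _⇛ᶦ_
data _⇛ˢ_ : Term → Term → Set where
  svar   : ∀ {x} → var x ⇛ˢ var x
  sapp   : ∀ {M M' N N'} → M ⇛ˢ M' → N ⇛ N' → app M N ⇛ˢ app M' N'
  sredex : ∀ {M M' N N'} → M ⇛ M' → N ⇛ N' → app (lam M) N ⇛ˢ app (lam M') N'

data _⇛ᶦ_ : Term → Term → Set where
  ilam   : ∀ {M M'} → M ⇛ M' → lam M ⇛ᶦ lam M'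
  ispine : ∀ {M M'} → M ⇛ˢ M' → M ⇛ᶦ M'

app-⇛ᶦ : ∀ {L M' N N'} → L ⇛ᶦ M' → N ⇛ N' → app L N ⇛ˢ app M' N'
app-⇛ᶦ (ilam p)   q = sredex p q
app-⇛ᶦ (ispine a) q = sapp a q

HeadFactor : Term → Term → Set
HeadFactor A B = ∃ λ L → Star _⟶ʷ_ A L × L ⇛ᶦ B

app-⟶ʷ* : ∀ {M L N} → Star _⟶ʷ_ M L → Star _⟶ʷ_ (app M N) (app L N)
app-⟶ʷ* = RT.gmap (λ M → app M _) wapp

sub-⟶ʷ : ∀ σ {M M'} → M ⟶ʷ M' → sub σ M ⟶ʷ sub σ M'
sub-⟶ʷ σ (wβ {M} {N}) = transport (app (lam (sub (exts σ) M)) (sub σ N) ⟶ʷ_) (sym (sub-[] σ M N)) wβ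
sub-⟶ʷ σ (wapp s)     = wapp (sub-⟶ʷ σ s)

sub-head-factorˢ : ∀ {σ τ} → (∀ x → σ x ⇛ τ x) → (∀ x → HeadFactor (σ x) (τ x)) →
                   ∀ {L M'} → L ⇛ˢ M' → HeadFactor (sub σ L) (sub τ M')
sub-head-factorˢ στ factor (svar {x}) = factor x
sub-head-factorˢ στ factor (sapp a q) with sub-head-factorˢ στ factor a
... | X , s , w = app X _ , app-⟶ʷ* s , ispine (app-⇛ᶦ w (sub-⇛ στ q))
sub-head-factorˢ στ factor (sredex p q) =
  _ , ε , ispine (sredex (sub-⇛ (exts-⇛ στ) p) (sub-⇛ στ q))

sub-head-factor : ∀ {σ τ} → (∀ x → σ x ⇛ τ x) → (∀ x → HeadFactor (σ x) (τ x)) →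
                  ∀ {L M'} → L ⇛ᶦ M' → HeadFactor (sub σ L) (sub τ M')
sub-head-factor στ factor (ilam p)   = _ , ε , ilam (sub-⇛ (exts-⇛ στ) p)
sub-head-factor στ factor (ispine a) = sub-head-factorˢ στ factor a

head-factor : ∀ {A B} → A ⇛ B → HeadFactor A B
head-factor pvar       = _ , ε , ispine svar
head-factor (plam p)   = _ , ε , ilam p
head-factor (papp p q) with head-factor p
... | L , s , w = app L _ , app-⟶ʷ* s , ispine (app-⇛ᶦ w q)
head-factor (pβ {M} {M'} {N} {N'} p q) with head-factor p
... | L , s , w with sub-head-factor (•id-⇛ q) factor-•id w
  where
  factor-•id : ∀ x → HeadFactor ((N •id) x) ((N' •id) x)
  factor-•id zero    = head-factor q
  factor-•id (suc x) = _ , ε , ispine svar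
... | X , s' , w' rewrite []-as-sub M' N' =
  X , wβ ◅ transport (λ T → Star _⟶ʷ_ T X) (sym ([]-as-sub M N)) (RT.gmap (sub (N •id)) (sub-⟶ʷ (N •id)) s ◅◅ s') ,
  w'

⇛ˢ-postpone : ∀ {L B B'} → L ⇛ˢ B → B ⟶ʷ B' → ∃ λ L' → L ⟶ʷ L' × L' ⇛ B'
⇛ˢ-postpone (sredex p q) wβ       = _ , wβ , []-⇛ p q
⇛ˢ-postpone (sredex p q) (wapp ())
⇛ˢ-postpone (sapp () q)  wβ
⇛ˢ-postpone (sapp a q)   (wapp s) with ⇛ˢ-postpone a s
... | L' , s' , r = app L' _ , wapp s' , papp r q

⇛ˢ-onto-neutral : ∀ {y L T} → L ⇛ˢ T → Neutral y T → ∃ λ Ms → ∃ λ Ms' →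
                  (L ≡ apps (var y) Ms) × (T ≡ apps (var y) Ms') × Pointwise _⇛_ Ms Ms'
⇛ˢ-onto-neutral svar nvar = [] , [] , refl , refl , []
⇛ˢ-onto-neutral (sapp {N = N} {N' = N'} a q) (napp n) with ⇛ˢ-onto-neutral a n
... | Ms , Ms' , refl , refl , args =
  Ms ++ N ∷ [] , Ms' ++ N' ∷ [] , sym (apps-snoc _ Ms N) , sym (apps-snoc _ Ms' N') , ++⁺ args (q ∷ [])
⇛ˢ-onto-neutral (sredex p q) (napp ())

⇛ˢ-onto-spine : ∀ {y L Ms'} → L ⇛ˢ apps (var y) Ms' →
                ∃ λ Ms → (L ≡ apps (var y) Ms) × Pointwise _⇛_ Ms Ms'
⇛ˢ-onto-spine {y} {Ms' = Ms'} a with ⇛ˢ-onto-neutral a (apps-neutral Ms' nvar)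
... | Ms , Ms'' , eL , eT , args with hnf-injective 0 y Ms' 0 y Ms'' eT
... | _ , _ , refl = Ms , eL , args

ReflectedHnf : (Term → Term → Set) → ℕ → ℕ → Term → ℕ → List Term → Set
ReflectedHnf R k' n A y Ms' =
  ∃ λ k → ∃ λ Ms → HeadSteps k A (lams n (apps (var y) Ms)) × k' ≤ k × Pointwise R Ms Ms'

mutual
  ⇛-reflects-hnf : ∀ k' n {A B y Ms'} → A ⇛ B → HeadSteps k' B (lams n (apps (var y) Ms')) →
                   ReflectedHnf _⇛_ k' n A y Ms'
  ⇛-reflects-hnf k' n p hs with head-factor p
  ... | L , s , w with weak⇒HeadSteps s | ⇛ᶦ-reflects-hnf k' n w hs
  ... | j , pre | k , Ms , h , k'≤k , args =
    j + k , Ms , HeadSteps-++ pre h , ≤-trans k'≤k (m≤n+m k j) , args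

  ⇛ᶦ-reflects-hnf : ∀ k' n {L B y Ms'} → L ⇛ᶦ B → HeadSteps k' B (lams n (apps (var y) Ms')) →
                    ReflectedHnf _⇛_ k' n L y Ms'
  ⇛ᶦ-reflects-hnf k' zero {Ms' = Ms'} (ilam p) hs with HeadSteps-unlam hs
  ... | _ , e , _ = ⊥-elim (neutral-not-lam (apps-neutral Ms' nvar) e)
  ⇛ᶦ-reflects-hnf k' (suc n) (ilam p) hs with HeadSteps-unlam hs
  ... | _ , refl , hs' with ⇛-reflects-hnf k' n p hs'
  ... | k , Ms , h , k'≤k , args = k , Ms , HeadSteps-lam h , k'≤k , args
  ⇛ᶦ-reflects-hnf zero zero {y = y} (ispine a) done with ⇛ˢ-onto-spine {y} a
  ... | Ms , refl , args = 0 , Ms , done , z≤n , args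
  ⇛ᶦ-reflects-hnf zero (suc n) (ispine ()) done
  ⇛ᶦ-reflects-hnf (suc k') n (ispine a) (step s rest) with →h⇒⟶h s
  ... | hlam _ = ⊥-elim (spine-not-lam a)
    where
    spine-not-lam : ∀ {L X} → ¬ (L ⇛ˢ lam X)
    spine-not-lam ()
  ... | hweak s' with ⇛ˢ-postpone a s'
  ... | L' , s'' , r with ⇛-reflects-hnf k' n r rest
  ... | k , Ms , h , k'≤k , args = suc k , Ms , step (⟶h⇒→h (hweak s'')) h , s≤s k'≤k , args

↠β-reflects-hnf : ∀ {A B k' n y Ms'} → A ↠β B → HeadSteps k' B (lams n (apps (var y) Ms')) →
                  ReflectedHnf _↠β_ k' n A y Ms'
↠β-reflects-hnf {k' = k'} {Ms' = Ms'} ε h = k' , Ms' , h , ≤-refl , pointwise-refl ε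
↠β-reflects-hnf {n = n} (s ◅ ss) h with ↠β-reflects-hnf ss h
... | k₁ , Ms₁ , h₁ , k'≤k₁ , args₁ with ⇛-reflects-hnf k₁ n (→β⊆⇛ s) h₁
... | k , Ms , h₂ , k₁≤k , args =
  k , Ms , h₂ , ≤-trans k'≤k₁ k₁≤k , compose-args args args₁
  where
  compose-args : ∀ {xs ys zs} → Pointwise _⇛_ xs ys → Pointwise _↠β_ ys zs → Pointwise _↠β_ xs zs
  compose-args = transitive (λ p q → ⇛⊆↠β p ◅◅ q)

-- 5. Reduction preserves head normal forms

neutral-⇛ : ∀ {y t C} → Neutral y t → t ⇛ C → Neutral y C
neutral-⇛ nvar     pvar       = nvar
neutral-⇛ (napp n) (papp p q) = napp (neutral-⇛ n p)
neutral-⇛ (napp ()) (pβ p q)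

hnf-⇛ : ∀ n {y Ms C} → lams n (apps (var y) Ms) ⇛ C → ∃ λ Ms' → C ≡ lams n (apps (var y) Ms')
hnf-⇛ zero    {Ms = Ms} p = neutral-spine (neutral-⇛ (apps-neutral Ms nvar) p)
hnf-⇛ (suc n) {y} {Ms} (plam p) with hnf-⇛ n {y} {Ms} p
... | Ms' , refl = Ms' , refl

hnf-↠β : ∀ n {y Ms C} → lams n (apps (var y) Ms) ↠β C → ∃ λ Ms' → C ≡ lams n (apps (var y) Ms')
hnf-↠β n {Ms = Ms} ε = Ms , refl
hnf-↠β n {y} {Ms} (s ◅ ss) with hnf-⇛ n {y} {Ms} (→β⊆⇛ s)
... | Ms₁ , refl = hnf-↠β n {y} {Ms₁} ss

↠β-preserves-hnf : ∀ {A B k n y Ms} → A ↠β B → HeadSteps k A (lams n (apps (var y) Ms)) →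
                   ∃ λ k' → ∃ λ Ms' → HeadSteps k' B (lams n (apps (var y) Ms'))
↠β-preserves-hnf {n = n} {y} {Ms} r h with β-confluent (HeadSteps⊆↠β h) r
... | C , hnf↠C , B↠C with hnf-↠β n {y} {Ms} hnf↠C
... | Ms'' , refl with ↠β-reflects-hnf {n = n} {y} {Ms''} B↠C done
... | k' , Ms' , hB , _ , _ = k' , Ms' , hB

↠β-hnf-clock : ∀ {A B k n y Ms} → A ↠β B → HeadSteps k A (lams n (apps (var y) Ms)) →
               ∃ λ k' → ∃ λ Ms' → HeadSteps k' B (lams n (apps (var y) Ms')) × k' ≤ k × Pointwise _↠β_ Ms Ms'
↠β-hnf-clock {n = n} {y} {Ms} r h with ↠β-preserves-hnf {n = n} {y} {Ms} r h
... | k' , Ms' , hB with ↠β-reflects-hnf {n = n} {y} {Ms'} r hB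
... | k₂ , Ms₂ , hA , k'≤k₂ , args
  with HeadSteps-deterministic (hnf-⟶h-normal n y Ms) (hnf-⟶h-normal n y Ms₂) h hA
... | refl , e with hnf-injective n y Ms n y Ms₂ e
... | _ , _ , refl = k' , Ms' , hB , k'≤k₂ , args

-- 6. Reduction makes the clocked Böhm tree faster

_≼_ : Label → Label → Set
ℓ₁ ≼ ℓ₂ = BTLabelEq ℓ₁ ℓ₂ × ClockRel _≤_ ℓ₁ ℓ₂

node-≼ : ∀ {k' k n y m m'} → m ≡ m' → k' ≤ k → node k' n y m ≼ node k n y m'
node-≼ refl k'≤k = node , node k'≤k

lookup-aligned : ∀ {R : Term → Term → Set} {xs ys} → Pointwise R xs ys → (i : Fin (length xs)) →
                 ∃ λ (j : Fin (length ys)) → (toℕ j ≡ toℕ i) × R (lookup xs i) (lookup ys j)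
lookup-aligned rs i = cast (Pointwise-length rs) i , toℕ-cast _ i , lookup⁺ rs i

lookup-aligned˘ : ∀ {R : Term → Term → Set} {xs ys} → Pointwise R xs ys → (i : Fin (length ys)) →
                  ∃ λ (j : Fin (length xs)) → (toℕ j ≡ toℕ i) × R (lookup xs j) (lookup ys i)
lookup-aligned˘ {R} rs = lookup-aligned (symmetric {S = λ y x → R x y} (λ r → r) rs)

reduct-position-in-source : ∀ {A B p ℓ₁} → A ↠β B → CBTAt B p ℓ₁ → ∃ λ ℓ₂ → CBTAt A p ℓ₂ × ℓ₁ ≼ ℓ₂
reduct-position-in-source r (here-bot B-no-hnf) = bot , here-bot A-no-hnf , bot , bot
  where
  A-no-hnf : ¬ HasHnf _
  A-no-hnf (k , n , y , Ms , h) with ↠β-preserves-hnf {n = n} {y} {Ms} r h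
  ... | k' , Ms' , hB = B-no-hnf (k' , n , y , Ms' , hB)
reduct-position-in-source r (here-node {n = n} {y} {Ms'} h) with ↠β-reflects-hnf {n = n} {y} {Ms'} r h
... | k , Ms , hA , k'≤k , args =
  node k n y (length Ms) , here-node {Ms = Ms} hA , node-≼ (sym (Pointwise-length args)) k'≤k
reduct-position-in-source r (child {n = n} {y} {Ms'} h i c) with ↠β-reflects-hnf {n = n} {y} {Ms'} r h
... | k , Ms , hA , _ , args with lookup-aligned˘ args i
... | j , j≡i , r' with reduct-position-in-source r' c
... | ℓ₂ , cA , ℓ₁≼ℓ₂ = ℓ₂ , transport (λ z → CBTAt _ (z ∷ _) ℓ₂) j≡i (child {Ms = Ms} hA j cA) , ℓ₁≼ℓ₂

source-position-in-reduct : ∀ {A B p ℓ₂} → A ↠β B → CBTAt A p ℓ₂ → ∃ λ ℓ₁ → CBTAt B p ℓ₁ × ℓ₁ ≼ ℓ₂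
source-position-in-reduct r (here-bot A-no-hnf) = bot , here-bot B-no-hnf , bot , bot
  where
  B-no-hnf : ¬ HasHnf _
  B-no-hnf (k' , n , y , Ms' , h) with ↠β-reflects-hnf {n = n} {y} {Ms'} r h
  ... | k , Ms , hA , _ , _ = A-no-hnf (k , n , y , Ms , hA)
source-position-in-reduct r (here-node {n = n} {y} {Ms} h) with ↠β-hnf-clock {n = n} {y} {Ms} r h
... | k' , Ms' , hB , k'≤k , args =
  node k' n y (length Ms') , here-node {Ms = Ms'} hB , node-≼ (sym (Pointwise-length args)) k'≤k
source-position-in-reduct r (child {n = n} {y} {Ms} h i c) with ↠β-hnf-clock {n = n} {y} {Ms} r h
... | k' , Ms' , hB , _ , args with lookup-aligned args i
... | j , j≡i , r' with source-position-in-reduct r' c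
... | ℓ₁ , cB , ℓ₁≼ℓ₂ = ℓ₁ , transport (λ z → CBTAt _ (z ∷ _) ℓ₁) j≡i (child {Ms = Ms'} hB j cB) , ℓ₁≼ℓ₂

TreeRel-× : ∀ {L₁ L₂ : Label → Label → Set} {s t} →
            TreeRel (λ ℓ₁ ℓ₂ → L₁ ℓ₁ ℓ₂ × L₂ ℓ₁ ℓ₂) s t → TreeRel L₁ s t × TreeRel L₂ s t
TreeRel-× T =
  (λ p → (λ ℓ c → map₂ (map₂ proj₁) (proj₁ (T p) ℓ c)) , (λ ℓ c → map₂ (map₂ proj₁) (proj₂ (T p) ℓ c))) ,
  (λ p → (λ ℓ c → map₂ (map₂ proj₂) (proj₁ (T p) ℓ c)) , (λ ℓ c → map₂ (map₂ proj₂) (proj₂ (T p) ℓ c)))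

reduct-⊑ : ∀ {A B} → A ↠β B → B ⊑ A
reduct-⊑ r = TreeRel-× (λ p → (λ ℓ₁ → reduct-position-in-source r) , (λ ℓ₂ → source-position-in-reduct r))

theorem22 : ∀ (M N : Term) →
    (∃ λ N' → N ↠β N' × (∀ M' → M ↠β M' → ¬ (M' ⊑ N'))) →
    ¬ (M =β N)
theorem22 M N (N' , N↠N' , no-reduct-⊑) M=N
  with confluent⇒church-rosser β-confluent (M=N ◅◅ a—↠b⇒a↔b N↠N')
... | Z , M↠Z , N'↠Z = no-reduct-⊑ Z M↠Z (reduct-⊑ N'↠Z)
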